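{- Let $G$ be a graph of order $n$, diameter $d$, with $k$ peripheral vertices. Then \[ WW(G)-\frac{d(d-1)}{2}\left[\binom{n}{2}-\binom{k}{2}\right]\le PWW(G)\le WW(G)-\binom{n}{2}+\binom{k}{2}. \]
   Context: All graphs are finite, simple, undirected, connected and have at least two vertices. $d(u,v)$ is the shortest-path distance. The eccentricity of $v$ is $\max_u d(u,v)$; the diameter is the maximum eccentricity; a vertex is peripheral if its eccentricity equals the diameter, and $\operatorname{Peri}(G)$ is the set of peripheral vertices. Sums range over unordered pairs of distinct vertices. $WW(G)=\frac12\sum_{\{u,v\}\subseteq V(G)}(d(u,v)+d(u,v)^2)$ and $PWW(G)=\frac12\sum_{\{u,v\}\subseteq \operatorname{Peri}(G)}(d(u,v)+d(u,v)^2)$. -}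

module Defs where

open import Data.Bool using (Bool; true; false; _∧_; _∨_; if_then_else_)
open import Data.Nat using (ℕ; zero; suc; _+_; _*_; _∸_; _⊔_; _/_)
open import Data.Fin using (Fin)
open import Data.Fin.Properties using (_≟_)
open import Data.List using (List; []; _∷_; map; _++_; foldr; filter; length; allFin)
open import Data.Bool.ListAction using (any)
open import Data.Nat.ListAction using (sum)
open import Data.Product using (_×_; _,_; ∃)
open import Relation.Nullary.Decidable using (⌊_⌋)
open import Relation.Binary.PropositionalEquality using (_≡_)
import Data.Nat.Properties as ℕP

record Graph (n : ℕ) : Set where
  field
    adj    : Fin n → Fin n → Bool
    sym    : ∀ u v → adj u v ≡ adj v u
    irrefl : ∀ u → adj u u ≡ false
open Graph public

module _ {n : ℕ} (G : Graph n) where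

  Reach : ℕ → Fin n → Fin n → Bool
  Reach zero    u v = ⌊ u ≟ v ⌋
  Reach (suc k) u v = Reach k u v ∨ any (λ w → adj G u w ∧ Reach k w v) (allFin n)

  Connected : Set
  Connected = ∀ u v → ∃ λ k → Reach k u v ≡ true

-- least k < m with p k ≡ true, or m if there is none
firstTrue : (ℕ → Bool) → ℕ → ℕ
firstTrue p zero    = zero
firstTrue p (suc m) = if p zero then zero else suc (firstTrue (λ k → p (suc k)) m)

maxList : List ℕ → ℕ
maxList = foldr _⊔_ 0

pairsOf : {A : Set} → List A → List (A × A)
pairsOf []       = []
pairsOf (x ∷ xs) = map (λ y → (x , y)) xs ++ pairsOf xs

module _ {n : ℕ} (G : Graph n) where

  -- shortest-path distance (in a connected graph every distance is < n)
  dist : Fin n → Fin n → ℕ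
  dist u v = firstTrue (λ k → Reach G k u v) n

  ecc : Fin n → ℕ
  ecc v = maxList (map (λ u → dist u v) (allFin n))

  diam : ℕ
  diam = maxList (map ecc (allFin n))

  Peri : List (Fin n)
  Peri = filter (λ v → ecc v ℕP.≟ diam) (allFin n)

  halfSumDD : List (Fin n) → ℕ
  halfSumDD xs = sum (map (λ p → let δ = dist (Data.Product.proj₁ p) (Data.Product.proj₂ p)
                                  in δ + δ * δ) (pairsOf xs)) / 2

  WW : ℕ
  WW = halfSumDD (allFin n)

  PWW : ℕ
  PWW = halfSumDD Peri

{-# OPTIONS --safe #-}
module Submission where

-- Split the pairs of vertices into the C(k,2) peripheral pairs and the C(n,2) − C(k,2) mixed
-- pairs, which have a non-peripheral end u. For a mixed pair 1 ≤ δ = d(u,v) ≤ ecc u ≤ d − 1, so its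
-- term δ + δ² lies between 2 and (d − 1)d. Summing and halving gives
-- PWW + (C(n,2) − C(k,2)) ≤ WW ≤ PWW + d(d − 1)/2 · (C(n,2) − C(k,2)).

open import Defs
open import Data.Nat using (ℕ; _≤_; _*_; _∸_; _/_)
open import Data.List using (length)
open import Data.Nat.Combinatorics using (_C_)
open import Data.Product using (_×_)
open import Data.Integer using (ℤ; +_; _-_; _+_) renaming (_*_ to _*ℤ_; _≤_ to _≤ℤ_)
open import Relation.Binary.PropositionalEquality using (_≡_)

import Data.Nat as ℕ
open import Data.Nat using (zero; suc; _<_; z≤n; s≤s)
open import Data.Nat.Properties
  using (≤-refl; ≤-trans; ≤-reflexive; ≤-<-trans; ≤∧≢⇒<; +-mono-≤; +-monoʳ-≤; *-mono-≤;
         *-assoc; *-comm; +-comm; m≤m⊔n; m≤n⊔m; m≤n+m; m+n∸n≡m)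
open import Data.Nat.Divisibility using (_∣_; _∣0; ∣m∣n⇒∣m+n; m∣m*n; n∣m*n)
open import Data.Nat.DivMod using (m/n*n≡m; m*n/n≡m; /-monoˡ-≤; +-distrib-/-∣ʳ)
open import Data.Nat.Combinatorics using (nC1≡n; nCk+nC[k+1]≡[n+1]C[k+1])
open import Data.Nat.ListAction using (sum)
open import Data.Nat.ListAction.Properties using (sum-++; sum-↭)
open import Data.Nat.Tactic.RingSolver using (solve-∀)
import Data.Integer.Properties as ℤ
open import Data.Integer using (-_; +≤+)
open import Data.Bool using (T; true; false; if_then_else_)
open import Data.Bool.Properties using (T-≡; T-∨; T-∧; ⇔→≡)
open import Data.Fin using (Fin)
open import Data.Fin.Properties using (_≟_)
open import Data.List using (List; []; _∷_; _++_; map; filter; allFin)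
open import Data.List.Properties using (filter-++; map-++; length-map; length-++; length-tabulate)
open import Data.List.Membership.Propositional using (_∈_; lose)
open import Data.List.Membership.Propositional.Properties using (∈-allFin; ∈-map⁺)
open import Data.List.Relation.Unary.Any using (here; there; satisfied)
open import Data.List.Relation.Unary.Any.Properties using (any⁺; any⁻)
open import Data.List.Relation.Unary.All as All using (All; []; _∷_)
open import Data.List.Relation.Unary.All.Properties using (++⁺; map⁺; all-filter; filter⁺)
open import Data.List.Relation.Unary.AllPairs using (AllPairs; []; _∷_)
open import Data.List.Relation.Unary.Unique.Propositional.Properties using (allFin⁺)
open import Data.List.Relation.Binary.Permutation.Propositional using (_↭_; ↭-refl; ↭-sym; ↭-trans; prep)
import Data.List.Relation.Binary.Permutation.Propositional.Properties as ↭
open import Data.Product using (_,_; proj₁; proj₂; ∃-syntax; uncurry)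
import Data.Product as Product
open import Data.Sum using (_⊎_; inj₁; inj₂)
import Data.Sum as Sum
open import Function using (_∘_; id; mk⇔; Equivalence)
open import Relation.Nullary using (¬_; yes; no; does; contradiction)
open import Relation.Nullary.Decidable using (toWitness; fromWitness)
open import Level using (0ℓ)
open import Relation.Unary using (Pred; Decidable; ∁; _⟨×⟩_)
open import Relation.Unary.Properties using (∁?; _×?_)
import Relation.Binary.PropositionalEquality as ≡
open ≡ using (refl; cong; cong₂; subst; _≗_; _≢_)
open Equivalence using (to; from)

pairsOf-length : ∀ {A : Set} (xs : List A) → length (pairsOf xs) ≡ length xs C 2
pairsOf-length []       = refl
pairsOf-length (x ∷ xs) = begin
  length (map (x ,_) xs ++ pairsOf xs)           ≡⟨ length-++ (map (x ,_) xs) ⟩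
  length (map (x ,_) xs) ℕ.+ length (pairsOf xs) ≡⟨ cong (ℕ._+ length (pairsOf xs)) (length-map _ xs) ⟩
  length xs ℕ.+ length (pairsOf xs)              ≡⟨ cong₂ ℕ._+_ (≡.sym (nC1≡n _)) (pairsOf-length xs) ⟩
  length xs C 1 ℕ.+ length xs C 2                ≡⟨ nCk+nC[k+1]≡[n+1]C[k+1] (length xs) 1 ⟩
  suc (length xs) C 2                            ∎
  where open ≡.≡-Reasoning

pairsOf⁺ : ∀ {r} {A : Set} {R : A → A → Set r} {xs} → AllPairs R xs → All (uncurry R) (pairsOf xs)
pairsOf⁺ []         = []
pairsOf⁺ (Rx ∷ Rxs) = ++⁺ (map⁺ Rx) (pairsOf⁺ Rxs)

module _ {p} {A : Set} {P : Pred A p} (P? : Decidable P) where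

  ↭-filter-∁ : ∀ xs → xs ↭ filter P? xs ++ filter (∁? P?) xs
  ↭-filter-∁ []       = ↭-refl
  ↭-filter-∁ (x ∷ xs) with does (P? x)
  ... | true  = prep x (↭-filter-∁ xs)
  ... | false = ↭-trans (prep x (↭-filter-∁ xs)) (↭-sym (↭.shift x (filter P? xs) _))

  private
    filter-row-accept : ∀ {x} → P x → ∀ ys → filter (P? ×? P?) (map (x ,_) ys) ≡ map (x ,_) (filter P? ys)
    filter-row-accept px []             = refl
    filter-row-accept {x} px (y ∷ ys) with P? x | P? y
    ... | yes _  | yes _ = cong ((x , y) ∷_) (filter-row-accept px ys)
    ... | yes _  | no _  = filter-row-accept px ys
    ... | no ¬px | _     = contradiction px ¬px

    filter-row-reject : ∀ {x} → ¬ P x → ∀ ys → filter (P? ×? P?) (map (x ,_) ys) ≡ []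
    filter-row-reject ¬px []           = refl
    filter-row-reject {x} ¬px (y ∷ ys) with P? x
    ... | yes px = contradiction px ¬px
    ... | no _   = filter-row-reject ¬px ys

  pairsOf-filter : ∀ xs → filter (P? ×? P?) (pairsOf xs) ≡ pairsOf (filter P? xs)
  pairsOf-filter []       = refl
  pairsOf-filter (x ∷ xs) with P? x
  ... | yes px = ≡.trans (filter-++ (P? ×? P?) (map (x ,_) xs) (pairsOf xs))
                         (cong₂ _++_ (filter-row-accept px xs) (pairsOf-filter xs))
  ... | no ¬px = ≡.trans (filter-++ (P? ×? P?) (map (x ,_) xs) (pairsOf xs))
                         (cong₂ _++_ (filter-row-reject ¬px xs) (pairsOf-filter xs))

module _ {a} {A : Set a} (f : A → ℕ) where

  sum-map-++ : ∀ xs ys → sum (map f (xs ++ ys)) ≡ sum (map f xs) ℕ.+ sum (map f ys)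
  sum-map-++ xs ys = ≡.trans (cong sum (map-++ f xs ys)) (sum-++ (map f xs) (map f ys))

  sum-map-↭ : ∀ {xs ys} → xs ↭ ys → sum (map f xs) ≡ sum (map f ys)
  sum-map-↭ xs↭ys = sum-↭ (↭.map⁺ f xs↭ys)

  length*≤sum-map : ∀ {m xs} → All (λ x → m ≤ f x) xs → length xs * m ≤ sum (map f xs)
  length*≤sum-map []         = ≤-refl
  length*≤sum-map (m≤ ∷ m≤s) = +-mono-≤ m≤ (length*≤sum-map m≤s)

  sum-map≤length* : ∀ {m xs} → All (λ x → f x ≤ m) xs → sum (map f xs) ≤ length xs * m
  sum-map≤length* []         = ≤-refl
  sum-map≤length* (≤m ∷ ≤ms) = +-mono-≤ ≤m (sum-map≤length* ≤ms)

∈⇒≤maxList : ∀ {m ms} → m ∈ ms → m ≤ maxList ms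
∈⇒≤maxList (here refl) = m≤m⊔n _ _
∈⇒≤maxList (there m∈)  = ≤-trans (∈⇒≤maxList m∈) (m≤n⊔m _ _)

firstTrue-cong : ∀ {p q} → p ≗ q → ∀ m → firstTrue p m ≡ firstTrue q m
firstTrue-cong p≗q zero    = refl
firstTrue-cong p≗q (suc m) =
  cong₂ (λ b j → if b then zero else suc j) (p≗q zero) (firstTrue-cong (p≗q ∘ suc) m)

weight : ℕ → ℕ
weight δ = δ ℕ.+ δ * δ

weight-mono-≤ : ∀ {δ ε} → δ ≤ ε → weight δ ≤ weight ε
weight-mono-≤ δ≤ε = +-mono-≤ δ≤ε (*-mono-≤ δ≤ε δ≤ε)

2∣weight : ∀ δ → 2 ∣ weight δ
2∣weight zero    = 2 ∣0
2∣weight (suc δ) = subst (2 ∣_) (step δ) (∣m∣n⇒∣m+n (2∣weight δ) (m∣m*n (suc δ)))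
  where
  step : ∀ δ → (δ ℕ.+ δ * δ) ℕ.+ 2 * suc δ ≡ suc δ ℕ.+ suc δ * suc δ
  step = solve-∀

-- d * (d ∸ 1) is weight (d ∸ 1), which is even, so the floor in d * (d ∸ 1) / 2 loses nothing.
weight<⇒≤ : ∀ {δ d} → δ < d → weight δ ≤ d * (d ∸ 1) / 2 * 2
weight<⇒≤ {d = suc e} (s≤s δ≤e) = ≤-trans (weight-mono-≤ δ≤e) (≤-reflexive (≡.sym (m/n*n≡m (2∣weight e))))

[m+n*2]/2≡m/2+n : ∀ m n → (m ℕ.+ n * 2) / 2 ≡ m / 2 ℕ.+ n
[m+n*2]/2≡m/2+n m n = ≡.trans (+-distrib-/-∣ʳ m (n∣m*n n)) (cong (m / 2 ℕ.+_) (m*n/n≡m n 2))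

/2-bounds : ∀ {s t u l h} → s ≡ t ℕ.+ u → l * 2 ≤ u → u ≤ h * 2 →
            t / 2 ℕ.+ l ≤ s / 2 × s / 2 ≤ t / 2 ℕ.+ h
/2-bounds {t = t} {l = l} {h} refl l*2≤u u≤h*2 =
  ≤-trans (≤-reflexive (≡.sym ([m+n*2]/2≡m/2+n t l))) (/-monoˡ-≤ 2 (+-monoʳ-≤ t l*2≤u)) ,
  ≤-trans (/-monoˡ-≤ 2 (+-monoʳ-≤ t u≤h*2)) (≤-reflexive ([m+n*2]/2≡m/2+n t h))

+[m+n]-+n≡+m : ∀ m n → + (m ℕ.+ n) - + n ≡ + m
+[m+n]-+n≡+m m n = ≡.trans (ℤ.[+m]-[+n]≡m⊖n (m ℕ.+ n) n) (≡.trans (ℤ.≤-⊖ (m≤n+m n m)) (cong +_ (m+n∸n≡m m n)))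

m≤n+o⇒+m-+o≤+n : ∀ {m n o} → m ≤ n ℕ.+ o → + m - + o ≤ℤ + n
m≤n+o⇒+m-+o≤+n {n = n} {o} m≤n+o = ℤ.≤-trans (ℤ.+-monoˡ-≤ (- + o) (+≤+ m≤n+o)) (ℤ.≤-reflexive (+[m+n]-+n≡+m n o))

n+o≤m⇒+n≤+m-+o : ∀ {m n o} → n ℕ.+ o ≤ m → + n ≤ℤ + m - + o
n+o≤m⇒+n≤+m-+o {n = n} {o} n+o≤m = ℤ.≤-trans (ℤ.≤-reflexive (≡.sym (+[m+n]-+n≡+m n o))) (ℤ.+-monoˡ-≤ (- + o) (+≤+ n+o≤m))

ℕ-bounds⇒ℤ-bounds : ∀ {ww pww m h nc kc} → nc ≡ kc ℕ.+ m → pww ℕ.+ m ≤ ww × ww ≤ pww ℕ.+ m * h →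
                    (+ ww - + h *ℤ (+ nc - + kc) ≤ℤ + pww) × (+ pww ≤ℤ (+ ww - + nc) + + kc)
ℕ-bounds⇒ℤ-bounds {ww} {pww} {m} {h} {kc = kc} refl (lower , upper) = lowerℤ , upperℤ
  where
  open ℤ.≤-Reasoning
  lowerℤ : + ww - + h *ℤ (+ (kc ℕ.+ m) - + kc) ≤ℤ + pww
  lowerℤ = begin
    + ww - + h *ℤ (+ (kc ℕ.+ m) - + kc) ≡⟨ cong (λ j → + ww - + h *ℤ (+ j - + kc)) (+-comm kc m) ⟩
    + ww - + h *ℤ (+ (m ℕ.+ kc) - + kc) ≡⟨ cong (λ i → + ww - + h *ℤ i) (+[m+n]-+n≡+m m kc) ⟩
    + ww - + h *ℤ + m                   ≡⟨ cong (λ i → + ww - i) (≡.sym (ℤ.pos-* h m)) ⟩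
    + ww - + (h * m)                    ≤⟨ m≤n+o⇒+m-+o≤+n (≤-trans upper (≤-reflexive (cong (pww ℕ.+_) (*-comm m h)))) ⟩
    + pww                               ∎
  upperℤ : + pww ≤ℤ (+ ww - + (kc ℕ.+ m)) + + kc
  upperℤ = begin
    + pww                                          ≤⟨ n+o≤m⇒+n≤+m-+o lower ⟩
    + ww - + m                                     ≡⟨ ≡.sym (ℤ.+-minus-telescope (+ ww) (+ (kc ℕ.+ m)) (+ m)) ⟩
    (+ ww - + (kc ℕ.+ m)) + (+ (kc ℕ.+ m) - + m) ≡⟨ cong (λ i → (+ ww - + (kc ℕ.+ m)) + i) (+[m+n]-+n≡+m kc m) ⟩
    (+ ww - + (kc ℕ.+ m)) + + kc                   ∎

dist>0 : ∀ {n} (G : Graph n) {u v : Fin n} → u ≢ v → 0 < dist G u v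
dist>0 {suc _} G {u} {v} u≢v with u ≟ v
... | yes u≡v = contradiction u≡v u≢v
... | no _    = s≤s z≤n

module _ {n : ℕ} (G : Graph n) where

  private
    Reach-suc⁺ : ∀ k u v → T (Reach G k u v) → T (Reach G (suc k) u v)
    Reach-suc⁺ k u v r = from T-∨ (inj₁ r)

    Reach-cons : ∀ k u w v → T (adj G u w) → T (Reach G k w v) → T (Reach G (suc k) u v)
    Reach-cons k u w v a r = from T-∨ (inj₂ (any⁺ _ (lose (∈-allFin w) (from T-∧ (a , r)))))

    Reach-suc⁻ : ∀ k u v → T (Reach G (suc k) u v) →
                 T (Reach G k u v) ⊎ ∃[ w ] (T (adj G u w) × T (Reach G k w v))
    Reach-suc⁻ k u v r = Sum.map₂ (Product.map₂ (to T-∧) ∘ satisfied ∘ any⁻ _ (allFin n)) (to T-∨ r)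

    Reach-snoc : ∀ k u v w → T (Reach G k u v) → T (adj G v w) → T (Reach G (suc k) u w)
    Reach-snoc zero u v w r a with toWitness {a? = u ≟ v} r
    ... | refl = Reach-cons zero u w w a (fromWitness {a? = w ≟ w} refl)
    Reach-snoc (suc k) u v w r a with Reach-suc⁻ k u v r
    ... | inj₁ r′              = Reach-suc⁺ (suc k) u w (Reach-snoc k u v w r′ a)
    ... | inj₂ (u′ , a′ , r′) = Reach-cons (suc k) u u′ w a′ (Reach-snoc k u′ v w r′ a)

    Reach-sym : ∀ k u v → T (Reach G k u v) → T (Reach G k v u)
    Reach-sym zero u v r with toWitness {a? = u ≟ v} r
    ... | refl = r
    Reach-sym (suc k) u v r with Reach-suc⁻ k u v r
    ... | inj₁ r′             = Reach-suc⁺ k v u (Reach-sym k u v r′)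
    ... | inj₂ (w , a , r′) = Reach-snoc k v w u (Reach-sym k w v r′) (subst T (sym G u w) a)

  Reach-comm : ∀ k u v → Reach G k u v ≡ Reach G k v u
  Reach-comm k u v = ⇔→≡ (mk⇔ (to T-≡ ∘ Reach-sym k u v ∘ from T-≡) (to T-≡ ∘ Reach-sym k v u ∘ from T-≡))

  dist-comm : ∀ u v → dist G u v ≡ dist G v u
  dist-comm u v = firstTrue-cong (λ k → Reach-comm k u v) n

  dist≤ecc : ∀ u v → dist G u v ≤ ecc G v
  dist≤ecc u v = ∈⇒≤maxList (∈-map⁺ (λ w → dist G w v) (∈-allFin u))

  ecc≤diam : ∀ v → ecc G v ≤ diam G
  ecc≤diam v = ∈⇒≤maxList (∈-map⁺ (ecc G) (∈-allFin v))

  Peripheral : Pred (Fin n) 0ℓ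
  Peripheral v = ecc G v ≡ diam G

  peripheral? : Decidable Peripheral
  peripheral? v = ecc G v ℕ.≟ diam G

  ecc<diam : ∀ {v} → ¬ Peripheral v → ecc G v < diam G
  ecc<diam {v} = ≤∧≢⇒< (ecc≤diam v)

  dist<diam : ∀ {u v} → ¬ (Peripheral u × Peripheral v) → dist G u v < diam G
  dist<diam {u} {v} ¬both with peripheral? u
  ... | yes pu  = ≤-<-trans (dist≤ecc u v) (ecc<diam (¬both ∘ (pu ,_)))
  ... | no ¬pu = ≤-<-trans (≤-trans (≤-reflexive (dist-comm u v)) (dist≤ecc v u)) (ecc<diam ¬pu)

  pairWeight : Fin n × Fin n → ℕ
  pairWeight (u , v) = weight (dist G u v)

  mixed? : Decidable (∁ (Peripheral ⟨×⟩ Peripheral))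
  mixed? = ∁? (peripheral? ×? peripheral?)

  mixedPairs : List (Fin n × Fin n)
  mixedPairs = filter mixed? (pairsOf (allFin n))

  pairsOf-↭ : pairsOf (allFin n) ↭ pairsOf (Peri G) ++ mixedPairs
  pairsOf-↭ = subst (λ ps → pairsOf (allFin n) ↭ ps ++ mixedPairs)
                    (pairsOf-filter peripheral? (allFin n))
                    (↭-filter-∁ (peripheral? ×? peripheral?) (pairsOf (allFin n)))

  mixedPairs-count : n C 2 ≡ length (Peri G) C 2 ℕ.+ length mixedPairs
  mixedPairs-count = begin
    n C 2                                                  ≡⟨ cong (_C 2) (≡.sym (length-tabulate {n = n} id)) ⟩
    length (allFin n) C 2                                  ≡⟨ ≡.sym (pairsOf-length (allFin n)) ⟩
    length (pairsOf (allFin n))                            ≡⟨ ↭.↭-length pairsOf-↭ ⟩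
    length (pairsOf (Peri G) ++ mixedPairs)                ≡⟨ length-++ (pairsOf (Peri G)) ⟩
    length (pairsOf (Peri G)) ℕ.+ length mixedPairs        ≡⟨ cong (ℕ._+ length mixedPairs) (pairsOf-length (Peri G)) ⟩
    length (Peri G) C 2 ℕ.+ length mixedPairs              ∎
    where open ≡.≡-Reasoning

  mixedPairs-weight : All (λ q → 2 ≤ pairWeight q × pairWeight q ≤ diam G * (diam G ∸ 1) / 2 * 2)
                        mixedPairs
  mixedPairs-weight =
    All.map bounds (All.zip (filter⁺ mixed? (pairsOf⁺ (allFin⁺ n)) , all-filter mixed? (pairsOf (allFin n))))
    where
    bounds : ∀ {q} → uncurry _≢_ q × ∁ (Peripheral ⟨×⟩ Peripheral) q →
             2 ≤ pairWeight q × pairWeight q ≤ diam G * (diam G ∸ 1) / 2 * 2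
    bounds {u , v} (u≢v , ¬both) = weight-mono-≤ (dist>0 G u≢v) , weight<⇒≤ (dist<diam {u} {v} ¬both)

  pairWeight-split : sum (map pairWeight (pairsOf (allFin n))) ≡
                     sum (map pairWeight (pairsOf (Peri G))) ℕ.+ sum (map pairWeight mixedPairs)
  pairWeight-split = ≡.trans (sum-map-↭ pairWeight pairsOf-↭) (sum-map-++ pairWeight (pairsOf (Peri G)) mixedPairs)

  WW-bounds : PWW G ℕ.+ length mixedPairs ≤ WW G ×
              WW G ≤ PWW G ℕ.+ length mixedPairs * (diam G * (diam G ∸ 1) / 2)
  WW-bounds = /2-bounds pairWeight-split
    (length*≤sum-map pairWeight (All.map proj₁ mixedPairs-weight))
    (≤-trans (sum-map≤length* pairWeight (All.map proj₂ mixedPairs-weight))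
             (≤-reflexive (≡.sym (*-assoc (length mixedPairs) _ 2))))

mainTheorem3 : (n : ℕ) → 2 ≤ n → (G : Graph n) → Connected G →
    (d k : ℕ) → diam G ≡ d → length (Peri G) ≡ k →
    ((+ WW G) - (+ ((d * (d ∸ 1)) / 2)) *ℤ ((+ (n C 2)) - (+ (k C 2))) ≤ℤ + PWW G)
    × (+ PWW G ≤ℤ ((+ WW G) - (+ (n C 2))) + (+ (k C 2)))
mainTheorem3 n _ G _ _ _ refl refl = ℕ-bounds⇒ℤ-bounds (mixedPairs-count G) (WW-bounds G)
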